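{- Every graph $G$ with no universal vertices or true twins has a unique (up to isomorphism) circular completion.
   Context: Graphs are finite with a loop at every vertex; $N[u]$ is the closed neighbourhood. Universal vertex: $N[u]=V$; true twins: $N[u]=N[v]$. Edge types: $uv$ is an inclusion edge if $N[u],N[v]$ are comparable under inclusion, otherwise an overlap edge; $\{u,v\}$ is a spanning pair if every $x\notin N[v]$ has $N[x]\subseteq N[u]$ and every $y\notin N[u]$ has $N[y]\subseteq N[v]$; an overlap edge is 2-overlap if its endpoints form a spanning pair, 1-overlap otherwise. $\{u,v\}$ is a circular pair if it is a spanning pair and $uv\notin E$. A graph is circularly-paired if every vertex belongs to some circular pair. A circular completion of $G$ is a circularly-paired graph $H$ with the minimum number of vertices such that $H$ contains $G$ as an induced subgraph and every edge of $G$ has the same type in $G$ and in $H$. -}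

module Defs where

open import Data.Nat using (ℕ; _≤_)
open import Data.Fin using (Fin)
open import Data.Bool using (Bool; true; false)
open import Data.Product using (Σ; ∃; _×_; _,_)
open import Data.Sum using (_⊎_)
open import Data.Empty using (⊥)
open import Relation.Nullary using (¬_)
open import Relation.Binary.PropositionalEquality using (_≡_)
open import Function.Bundles using (_⇔_)

record Graph : Set where
  field
    size  : ℕ
    adj   : Fin size → Fin size → Bool
    adj-refl : ∀ u → adj u u ≡ true
    adj-sym  : ∀ u v → adj u v ≡ adj v u
open Graph public

V : Graph → Set
V G = Fin (size G)

Edge : (G : Graph) → V G → V G → Set
Edge G u v = adj G u v ≡ true

NbhdSub : (G : Graph) → V G → V G → Set
NbhdSub G u v = ∀ x → adj G u x ≡ true → adj G v x ≡ true

Universal : (G : Graph) → V G → Set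
Universal G u = ∀ x → adj G u x ≡ true

TrueTwins : (G : Graph) → V G → V G → Set
TrueTwins G u v = ∀ x → adj G u x ≡ adj G v x

NoUniversal : Graph → Set
NoUniversal G = ∀ u → ¬ Universal G u

NoTrueTwins : Graph → Set
NoTrueTwins G = ∀ u v → TrueTwins G u v → u ≡ v

Comparable : (G : Graph) → V G → V G → Set
Comparable G u v = NbhdSub G u v ⊎ NbhdSub G v u

SpanningPair : (G : Graph) → V G → V G → Set
SpanningPair G u v =
  (∀ x → adj G v x ≡ false → NbhdSub G x u) ×
  (∀ y → adj G u y ≡ false → NbhdSub G y v)

InclusionEdge : (G : Graph) → V G → V G → Set
InclusionEdge G u v = Edge G u v × Comparable G u v

OverlapEdge : (G : Graph) → V G → V G → Set
OverlapEdge G u v = Edge G u v × ¬ Comparable G u v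

TwoOverlapEdge : (G : Graph) → V G → V G → Set
TwoOverlapEdge G u v = OverlapEdge G u v × SpanningPair G u v

OneOverlapEdge : (G : Graph) → V G → V G → Set
OneOverlapEdge G u v = OverlapEdge G u v × ¬ SpanningPair G u v

CircularPair : (G : Graph) → V G → V G → Set
CircularPair G u v = SpanningPair G u v × adj G u v ≡ false

CircularlyPaired : Graph → Set
CircularlyPaired G = ∀ u → ∃ λ v → CircularPair G u v

InducedEmbedding : (G H : Graph) → (V G → V H) → Set
InducedEmbedding G H f =
  (∀ u v → f u ≡ f v → u ≡ v) ×
  (∀ u v → adj H (f u) (f v) ≡ adj G u v)

PreservesEdgeTypes : (G H : Graph) → (V G → V H) → Set
PreservesEdgeTypes G H f =
  ∀ u v → Edge G u v →
    (InclusionEdge G u v ⇔ InclusionEdge H (f u) (f v)) ×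
    (TwoOverlapEdge G u v ⇔ TwoOverlapEdge H (f u) (f v)) ×
    (OneOverlapEdge G u v ⇔ OneOverlapEdge H (f u) (f v))

CircularExtension : Graph → Graph → Set
CircularExtension G H =
  CircularlyPaired H ×
  Σ (V G → V H) λ f → InducedEmbedding G H f × PreservesEdgeTypes G H f

CircularCompletion : Graph → Graph → Set
CircularCompletion G H =
  CircularExtension G H × (∀ H' → CircularExtension G H' → size H ≤ size H')

record Iso (G H : Graph) : Set where
  field
    to      : V G → V H
    from    : V H → V G
    from∘to : ∀ u → from (to u) ≡ u
    to∘from : ∀ w → to (from w) ≡ w
    adj-pres : ∀ u v → adj H (to u) (to v) ≡ adj G u v

-- Call u unpaired if it lies in no circular pair. Adding, for every unpaired u, a
-- new vertex u′ adjacent to a ∈ V(G) iff N[a] ⊈ N[u], and to another z′ iff uz is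
-- not a 2-overlap edge, keeps all inclusions and spanning pairs of G and makes
-- {u, u′} a circular pair. Conversely, in any circularly-paired extension the
-- circular partners of the unpaired vertices are distinct (there are no true twins)
-- and lie outside G, so no extension is smaller; and once edge types are preserved,
-- the adjacencies between G and these partners are forced to be the ones above.

module Submission where

open import Defs
open import Data.Bool using (Bool; true; false)
open import Data.Bool.Properties using (⇔→≡) renaming (_≟_ to _≟ᵇ_)
open import Data.Empty using (⊥; ⊥-elim)
open import Data.Fin using (Fin; zero; suc; punchOut; splitAt; join)
open import Data.Fin.Properties
  using (all?; any?; injective⇒≤; punchOut-injective; suc-injective; splitAt-join; join-splitAt)
  renaming (_≟_ to _≟ᶠ_)
open import Data.Nat using (ℕ; zero; suc; _+_; _≤_)
open import Data.Nat.Properties using (≤-trans; 1+n≰n)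
open import Data.Product using (Σ; ∃; _×_; _,_; proj₁; proj₂; swap)
open import Data.Sum using (_⊎_; inj₁; inj₂; [_,_]) renaming (map to ⊎-map; swap to ⊎-swap)
open import Data.Sum.Properties using (inj₁-injective)
open import Function using (_∘_)
open import Function.Bundles using (mk⇔; Equivalence)
open import Relation.Nullary using (¬_; Dec; yes; no; does)
open import Relation.Nullary.Decidable
  using (dec-true; dec-false; does-⇔; decidable-stable; _×-dec_; _⊎-dec_; ¬?; _→-dec_)
open import Relation.Binary.PropositionalEquality
  using (_≡_; _≢_; refl; sym; trans; cong; cong₂; subst; subst₂; module ≡-Reasoning)

≢true⇒≡false : ∀ {b} → ¬ b ≡ true → b ≡ false
≢true⇒≡false {true}  b≢true = ⊥-elim (b≢true refl)
≢true⇒≡false {false} _      = refl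

≢false⇒≡true : ∀ {b} → ¬ b ≡ false → b ≡ true
≢false⇒≡true {true}  _       = refl
≢false⇒≡true {false} b≢false = ⊥-elim (b≢false refl)

≡false⇒≢true : ∀ {b} → b ≡ false → ¬ b ≡ true
≡false⇒≢true refl ()

module _ {A : Set} where

  does≡true⇒ : (a? : Dec A) → does a? ≡ true → A
  does≡true⇒ (yes a) _ = a
  does≡true⇒ (no _) ()

  does≡false⇒ : (a? : Dec A) → does a? ≡ false → ¬ A
  does≡false⇒ (yes _) ()
  does≡false⇒ (no ¬a) _ = ¬a

record Enumeration (n : ℕ) (P : Fin n → Set) : Set where
  field
    count     : ℕ
    elem      : Fin count → Fin n
    injective : ∀ i j → elem i ≡ elem j → i ≡ j
    sound     : ∀ i → P (elem i)
    complete  : ∀ u → P u → Σ (Fin count) λ i → elem i ≡ u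

module _ {n : ℕ} {P : Fin (suc n) → Set} (E : Enumeration n (λ u → P (suc u))) where
  open Enumeration E

  skipZero : ¬ P zero → Enumeration (suc n) P
  skipZero ¬P₀ = record
    { count     = count
    ; elem      = λ i → suc (elem i)
    ; injective = λ i j eq → injective i j (suc-injective eq)
    ; sound     = sound
    ; complete  = complete′
    }
    where
    complete′ : ∀ u → P u → Σ (Fin count) λ i → suc (elem i) ≡ u
    complete′ zero    P₀ = ⊥-elim (¬P₀ P₀)
    complete′ (suc u) Pu = let i , eq = complete u Pu in i , cong suc eq

  keepZero : P zero → Enumeration (suc n) P
  keepZero P₀ = record
    { count     = suc count
    ; elem      = elem′
    ; injective = injective′
    ; sound     = sound′
    ; complete  = complete′
    }
    where
    elem′ : Fin (suc count) → Fin (suc n)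
    elem′ zero    = zero
    elem′ (suc i) = suc (elem i)

    injective′ : ∀ i j → elem′ i ≡ elem′ j → i ≡ j
    injective′ zero    zero    _  = refl
    injective′ (suc i) (suc j) eq = cong suc (injective i j (suc-injective eq))

    sound′ : ∀ i → P (elem′ i)
    sound′ zero    = P₀
    sound′ (suc i) = sound i

    complete′ : ∀ u → P u → Σ (Fin (suc count)) λ i → elem′ i ≡ u
    complete′ zero    _  = zero , refl
    complete′ (suc u) Pu = let i , eq = complete u Pu in suc i , cong suc eq

enumerate : ∀ {n} {P : Fin n → Set} → (∀ u → Dec (P u)) → Enumeration n P
enumerate {zero} _ = record
  { count = 0 ; elem = λ () ; injective = λ () ; sound = λ () ; complete = λ () }
enumerate {suc n} {P} P? with P? zero
... | yes P₀ = keepZero (enumerate (λ u → P? (suc u))) P₀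
... | no ¬P₀ = skipZero (enumerate (λ u → P? (suc u))) ¬P₀

-- A value y outside the image could be punched out, injecting Fin m into a smaller Fin.
injective⇒surjective : ∀ {m n} (f : Fin m → Fin n) → (∀ i j → f i ≡ f j → i ≡ j) →
                       n ≤ m → ∀ y → ∃ λ x → f x ≡ y
injective⇒surjective {m} {suc n} f f-inj n≤m y with any? (λ x → f x ≟ᶠ y)
... | yes hit = hit
... | no miss = ⊥-elim (1+n≰n (≤-trans n≤m (injective⇒≤ {f = f∖y} f∖y-injective)))
  where
  f≢y : ∀ x → ¬ y ≡ f x
  f≢y x y≡fx = miss (x , sym y≡fx)

  f∖y : Fin m → Fin n
  f∖y x = punchOut (f≢y x)

  f∖y-injective : ∀ {x x′} → f∖y x ≡ f∖y x′ → x ≡ x′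
  f∖y-injective {x} {x′} eq = f-inj x x′ (punchOut-injective (f≢y x) (f≢y x′) eq)

-- Inclusions of closed neighbourhoods and spanning pairs in a graph

Unpaired : (G : Graph) → V G → Set
Unpaired G u = ¬ ∃ (CircularPair G u)

module Neighbourhoods (G : Graph) where

  infix 4 _⊆_
  _⊆_ : V G → V G → Set
  _⊆_ = NbhdSub G

  ⊆-refl : ∀ {u} → u ⊆ u
  ⊆-refl _ ux = ux

  ⊆-trans : ∀ {u v w} → u ⊆ v → v ⊆ w → u ⊆ w
  ⊆-trans u⊆v v⊆w x ux = v⊆w x (u⊆v x ux)

  ⊆⇒adj : ∀ {x a} → x ⊆ a → adj G a x ≡ true
  ⊆⇒adj {x} x⊆a = x⊆a x (adj-refl G x)

  ⊆-nonadj : ∀ {a b x} → a ⊆ b → adj G b x ≡ false → adj G a x ≡ false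
  ⊆-nonadj {x = x} a⊆b b≁x = ≢true⇒≡false λ a~x → ≡false⇒≢true b≁x (a⊆b x a~x)

  ⊆-antisym : NoTrueTwins G → ∀ {u v} → u ⊆ v → v ⊆ u → u ≡ v
  ⊆-antisym no-twins {u} {v} u⊆v v⊆u = no-twins u v λ x → ⇔→≡ (mk⇔ (u⊆v x) (v⊆u x))

  spanningPair-sym : ∀ {a b} → SpanningPair G a b → SpanningPair G b a
  spanningPair-sym = swap

  spanningPair-mono : ∀ {a b a′ b′} → SpanningPair G a b → a ⊆ a′ → b ⊆ b′ →
                      SpanningPair G a′ b′
  spanningPair-mono (a-span , b-span) a⊆a′ b⊆b′ =
    (λ x b′≁x → ⊆-trans (a-span x (⊆-nonadj b⊆b′ b′≁x)) a⊆a′) ,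
    (λ y a′≁y → ⊆-trans (b-span y (⊆-nonadj a⊆a′ a′≁y)) b⊆b′)

  spanningPair⇒no-upper-bound : NoUniversal G → ∀ {a b c} →
                                SpanningPair G a b → a ⊆ c → b ⊆ c → ⊥
  spanningPair⇒no-upper-bound no-universal {a} {b} {c} (a-span , _) a⊆c b⊆c =
    no-universal c c-universal
    where
    c-universal : Universal G c
    c-universal x with adj G b x in b~x
    ... | true  = b⊆c x b~x
    ... | false = a⊆c x (⊆⇒adj (a-span x b~x))

  twoOverlap⇒spanningPair : ∀ {u v} → TwoOverlapEdge G u v → SpanningPair G u v
  twoOverlap⇒spanningPair = proj₂

  twoOverlap⇒incomparable : ∀ {u v} → TwoOverlapEdge G u v → ¬ Comparable G u v
  twoOverlap⇒incomparable ((_ , incomparable) , _) = incomparable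

  twoOverlap-irrefl : ∀ {u} → ¬ TwoOverlapEdge G u u
  twoOverlap-irrefl two = twoOverlap⇒incomparable two (inj₁ ⊆-refl)

  twoOverlap-sym : ∀ {u v} → TwoOverlapEdge G u v → TwoOverlapEdge G v u
  twoOverlap-sym {u} {v} ((u~v , incomparable) , span) =
    (trans (adj-sym G v u) u~v , incomparable ∘ ⊎-swap) , spanningPair-sym span

  unpaired-spanningPair⇒twoOverlap : ∀ {u w} → Unpaired G u → SpanningPair G u w →
                                     ¬ Comparable G u w → TwoOverlapEdge G u w
  unpaired-spanningPair⇒twoOverlap {w = w} unpaired span incomparable =
    (≢false⇒≡true (λ u≁w → unpaired (w , span , u≁w)) , incomparable) , span

  dominating-spanningPair⇒twoOverlap : NoUniversal G → ∀ {a b w w′} → Unpaired G w →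
                                       SpanningPair G a b → a ⊆ w → b ⊆ w′ →
                                       TwoOverlapEdge G w w′
  dominating-spanningPair⇒twoOverlap no-universal unpaired span a⊆w b⊆w′ =
    unpaired-spanningPair⇒twoOverlap unpaired (spanningPair-mono span a⊆w b⊆w′)
      [ (λ w⊆w′ → no-upper-bound (⊆-trans a⊆w w⊆w′) b⊆w′)
      , (λ w′⊆w → no-upper-bound a⊆w (⊆-trans b⊆w′ w′⊆w)) ]
    where
    no-upper-bound : ∀ {c} → _ ⊆ c → _ ⊆ c → ⊥
    no-upper-bound = spanningPair⇒no-upper-bound no-universal span

  _⊆?_ : ∀ u v → Dec (u ⊆ v)
  u ⊆? v = all? λ x → (adj G u x ≟ᵇ true) →-dec (adj G v x ≟ᵇ true)

  spanningPair? : ∀ u v → Dec (SpanningPair G u v)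
  spanningPair? u v =
    all? (λ x → (adj G v x ≟ᵇ false) →-dec (x ⊆? u)) ×-dec
    all? (λ y → (adj G u y ≟ᵇ false) →-dec (y ⊆? v))

  twoOverlap? : ∀ u v → Dec (TwoOverlapEdge G u v)
  twoOverlap? u v =
    ((adj G u v ≟ᵇ true) ×-dec ¬? ((u ⊆? v) ⊎-dec (v ⊆? u))) ×-dec spanningPair? u v

  circularPartner? : ∀ u → Dec (∃ (CircularPair G u))
  circularPartner? u = any? λ v → spanningPair? u v ×-dec (adj G u v ≟ᵇ false)

-- Maps preserving adjacency

module AdjacencyPreserving (G H : Graph) (f : V G → V H)
                           (f-adj : ∀ u v → adj H (f u) (f v) ≡ adj G u v) where

  nbhdSub-reflect : ∀ {u v} → NbhdSub H (f u) (f v) → NbhdSub G u v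
  nbhdSub-reflect {u} {v} fu⊆fv x u~x =
    trans (sym (f-adj v x)) (fu⊆fv (f x) (trans (f-adj u x) u~x))

  spanningPair-reflect : ∀ {u v} → SpanningPair H (f u) (f v) → SpanningPair G u v
  spanningPair-reflect {u} {v} (fu-span , fv-span) =
    (λ x v≁x → nbhdSub-reflect (fu-span (f x) (trans (f-adj v x) v≁x))) ,
    (λ y u≁y → nbhdSub-reflect (fv-span (f y) (trans (f-adj u y) u≁y)))

  circularPair-reflect : ∀ {u v} → CircularPair H (f u) (f v) → CircularPair G u v
  circularPair-reflect {u} {v} (span , fu≁fv) =
    spanningPair-reflect span , trans (sym (f-adj u v)) fu≁fv

  preservesEdgeTypes : (∀ {u v} → NbhdSub G u v → NbhdSub H (f u) (f v)) →
                       (∀ {u v} → SpanningPair G u v → SpanningPair H (f u) (f v)) →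
                       PreservesEdgeTypes G H f
  preservesEdgeTypes ⊆-pres span-pres u v _ =
    mk⇔ (λ (e , c) → edge e , comparable c) (λ (e , c) → edge⁻ e , comparable⁻ c) ,
    mk⇔ (λ ((e , ¬c) , s) → (edge e , λ c → ¬c (comparable⁻ c)) , span-pres s)
        (λ ((e , ¬c) , s) → (edge⁻ e , λ c → ¬c (comparable c)) , spanningPair-reflect s) ,
    mk⇔ (λ ((e , ¬c) , ¬s) → (edge e , λ c → ¬c (comparable⁻ c)) , λ s → ¬s (spanningPair-reflect s))
        (λ ((e , ¬c) , ¬s) → (edge⁻ e , λ c → ¬c (comparable c)) , λ s → ¬s (span-pres s))
    where
    edge : Edge G u v → Edge H (f u) (f v)
    edge = trans (f-adj u v)
    edge⁻ : Edge H (f u) (f v) → Edge G u v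
    edge⁻ = trans (sym (f-adj u v))
    comparable : Comparable G u v → Comparable H (f u) (f v)
    comparable = [ (λ s → inj₁ (⊆-pres s)) , (λ s → inj₂ (⊆-pres s)) ]
    comparable⁻ : Comparable H (f u) (f v) → Comparable G u v
    comparable⁻ = [ (λ s → inj₁ (nbhdSub-reflect s)) , (λ s → inj₂ (nbhdSub-reflect s)) ]

-- The completion

module Completion (G : Graph) (no-universal : NoUniversal G) (no-twins : NoTrueTwins G) where

  open Neighbourhoods G

  n : ℕ
  n = size G

  open Enumeration (enumerate (λ u → ¬? (circularPartner? u)))
    renaming ( count to k; elem to anchor; injective to anchor-injective
             ; sound to anchor-unpaired; complete to anchor-complete )

  W : Set
  W = Fin n ⊎ Fin k

  -- new i is the circular partner added for the unpaired vertex anchor i.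
  pattern old a = inj₁ a
  pattern new i = inj₂ i

  adjᶜ : W → W → Bool
  adjᶜ (old a) (old b) = adj G a b
  adjᶜ (old a) (new i) = does (¬? (a ⊆? anchor i))
  adjᶜ (new i) (old a) = does (¬? (a ⊆? anchor i))
  adjᶜ (new i) (new j) = does ((i ≟ᶠ j) ⊎-dec ¬? (twoOverlap? (anchor i) (anchor j)))

  infix 4 _~_ _≁_ _≼_
  _~_ _≁_ : W → W → Set
  a ~ b = adjᶜ a b ≡ true
  a ≁ b = adjᶜ a b ≡ false

  -- NbhdSub and SpanningPair of the completion, read on W before numbering its vertices.
  _≼_ : W → W → Set
  a ≼ b = ∀ w → a ~ w → b ~ w

  Spanning : W → W → Set
  Spanning a b = (∀ x → b ≁ x → x ≼ a) × (∀ y → a ≁ y → y ≼ b)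

  module _ {i : Fin k} {a : Fin n} where

    new~old⇒ : new i ~ old a → ¬ a ⊆ anchor i
    new~old⇒ = does≡true⇒ (¬? (a ⊆? anchor i))

    new~old⇐ : ¬ a ⊆ anchor i → new i ~ old a
    new~old⇐ = dec-true (¬? (a ⊆? anchor i))

    new≁old⇒ : new i ≁ old a → a ⊆ anchor i
    new≁old⇒ = decidable-stable (a ⊆? anchor i) ∘ does≡false⇒ (¬? (a ⊆? anchor i))

    new≁old⇐ : a ⊆ anchor i → new i ≁ old a
    new≁old⇐ a⊆u = dec-false (¬? (a ⊆? anchor i)) λ a⊈u → a⊈u a⊆u

  module _ {i j : Fin k} where

    new~new⇒ : new i ~ new j → i ≡ j ⊎ ¬ TwoOverlapEdge G (anchor i) (anchor j)
    new~new⇒ = does≡true⇒ ((i ≟ᶠ j) ⊎-dec ¬? (twoOverlap? (anchor i) (anchor j)))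

    new~new⇐ : i ≡ j ⊎ ¬ TwoOverlapEdge G (anchor i) (anchor j) → new i ~ new j
    new~new⇐ = dec-true ((i ≟ᶠ j) ⊎-dec ¬? (twoOverlap? (anchor i) (anchor j)))

    new≁new⇒ : new i ≁ new j → TwoOverlapEdge G (anchor i) (anchor j)
    new≁new⇒ i≁j = decidable-stable (twoOverlap? (anchor i) (anchor j)) λ ¬two →
      does≡false⇒ ((i ≟ᶠ j) ⊎-dec ¬? (twoOverlap? (anchor i) (anchor j))) i≁j (inj₂ ¬two)

  adjᶜ-refl : ∀ w → w ~ w
  adjᶜ-refl (old a) = adj-refl G a
  adjᶜ-refl (new i) = new~new⇐ (inj₁ refl)

  adjᶜ-sym : ∀ a b → adjᶜ a b ≡ adjᶜ b a
  adjᶜ-sym (old a) (old b) = adj-sym G a b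
  adjᶜ-sym (old a) (new i) = refl
  adjᶜ-sym (new i) (old a) = refl
  adjᶜ-sym (new i) (new j) = does-⇔ (mk⇔ flip flip)
    ((i ≟ᶠ j) ⊎-dec ¬? (twoOverlap? (anchor i) (anchor j)))
    ((j ≟ᶠ i) ⊎-dec ¬? (twoOverlap? (anchor j) (anchor i)))
    where
    flip : ∀ {i j} → i ≡ j ⊎ ¬ TwoOverlapEdge G (anchor i) (anchor j) →
                     j ≡ i ⊎ ¬ TwoOverlapEdge G (anchor j) (anchor i)
    flip = ⊎-map sym (λ ¬two → ¬two ∘ twoOverlap-sym)

  ≼-old : ∀ {a b} → a ⊆ b → old a ≼ old b
  ≼-old a⊆b (old x) a~x = a⊆b x a~x
  ≼-old a⊆b (new i) a~i = new~old⇐ λ b⊆u → new~old⇒ a~i (⊆-trans a⊆b b⊆u)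

  new≼old : ∀ {a b i} → SpanningPair G a b → b ⊆ anchor i → new i ≼ old a
  new≼old (_ , b-span) b⊆u (old y) i~y =
    ≢false⇒≡true λ a≁y → new~old⇒ i~y (⊆-trans (b-span y a≁y) b⊆u)
  new≼old {i = i} span b⊆u (new j) i~j = new~old⇐ λ a⊆uj →
    let two = dominating-spanningPair⇒twoOverlap no-universal (anchor-unpaired i)
                (spanningPair-sym span) b⊆u a⊆uj
    in [ (λ { refl → twoOverlap-irrefl two }) , (λ ¬two → ¬two two) ] (new~new⇒ i~j)

  spanning-old : ∀ {a b} → SpanningPair G a b → Spanning (old a) (old b)
  spanning-old span = dominated span , dominated (spanningPair-sym span)
    where
    dominated : ∀ {a b} → SpanningPair G a b → ∀ x → old b ≁ x → x ≼ old a
    dominated (a-span , _) (old x) b≁x = ≼-old (a-span x b≁x)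
    dominated span         (new i) b≁i = new≼old span (new≁old⇒ b≁i)

  spanning-new : ∀ i → Spanning (old (anchor i)) (new i)
  spanning-new i = below , above
    where
    u = anchor i

    below : ∀ x → new i ≁ x → x ≼ old u
    below (old y) i≁y = ≼-old (new≁old⇒ i≁y)
    below (new j) i≁j = new≼old (twoOverlap⇒spanningPair (new≁new⇒ i≁j)) ⊆-refl

    above : ∀ y → old u ≁ y → y ≼ new i
    above (old t) u≁t (old s) t~s = new~old⇐ λ s⊆u →
      ≡false⇒≢true u≁t (s⊆u t (trans (adj-sym G s t) t~s))
    above (old t) u≁t (new j) t~j = new~new⇐ (inj₂ λ two →
      new~old⇒ t~j (proj₂ (twoOverlap⇒spanningPair two) t u≁t))
    above (new j) u≁j (old s) j~s = new~old⇐ λ s⊆u →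
      new~old⇒ j~s (⊆-trans s⊆u (new≁old⇒ u≁j))
    above (new j) u≁j (new l) j~l = new~new⇐ (inj₂ λ two →
      [ (λ { refl → twoOverlap⇒incomparable two (inj₁ u⊆uj) })
      , (λ ¬two → ¬two (dominating-spanningPair⇒twoOverlap no-universal (anchor-unpaired j)
                          (twoOverlap⇒spanningPair two) u⊆uj ⊆-refl)) ]
      (new~new⇒ j~l))
      where
      u⊆uj : u ⊆ anchor j
      u⊆uj = new≁old⇒ u≁j

  circularPartner : ∀ w → ∃ λ w′ → Spanning w w′ × w ≁ w′
  circularPartner (new i) = old (anchor i) , swap (spanning-new i) , new≁old⇐ ⊆-refl
  circularPartner (old v) with circularPartner? v
  ... | yes (v′ , span , v≁v′) = old v′ , spanning-old span , v≁v′
  ... | no unpaired with anchor-complete v unpaired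
  ...   | i , refl = new i , spanning-new i , new≁old⇐ ⊆-refl

  H : Graph
  H = record
    { size     = n + k
    ; adj      = λ x y → adjᶜ (splitAt n x) (splitAt n y)
    ; adj-refl = λ x → adjᶜ-refl (splitAt n x)
    ; adj-sym  = λ x y → adjᶜ-sym (splitAt n x) (splitAt n y)
    }

  vertex : W → V H
  vertex = join n k

  splitAt-vertex : ∀ w → splitAt n (vertex w) ≡ w
  splitAt-vertex = splitAt-join n k

  ≼⇒nbhdSub : ∀ {x y} → splitAt n x ≼ splitAt n y → NbhdSub H x y
  ≼⇒nbhdSub x≼y t = x≼y (splitAt n t)

  spanning⇒spanningPair : ∀ {x y} → Spanning (splitAt n x) (splitAt n y) → SpanningPair H x y
  spanning⇒spanningPair (x-span , y-span) =
    (λ t y≁t → ≼⇒nbhdSub (x-span (splitAt n t) y≁t)) ,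
    (λ t x≁t → ≼⇒nbhdSub (y-span (splitAt n t) x≁t))

  circularlyPaired : CircularlyPaired H
  circularlyPaired x =
    let w′ , span , x≁w′ = circularPartner (splitAt n x)
    in vertex w′
     , spanning⇒spanningPair (subst (Spanning (splitAt n x)) (sym (splitAt-vertex w′)) span)
     , trans (cong (adjᶜ (splitAt n x)) (splitAt-vertex w′)) x≁w′

  embed : V G → V H
  embed a = vertex (old a)

  embed-injective : ∀ u v → embed u ≡ embed v → u ≡ v
  embed-injective u v eq = inj₁-injective (begin
    old u                       ≡⟨ sym (splitAt-vertex (old u)) ⟩
    splitAt n (embed u)         ≡⟨ cong (splitAt n) eq ⟩
    splitAt n (embed v)         ≡⟨ splitAt-vertex (old v) ⟩
    old v                       ∎)
    where open ≡-Reasoning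

  embed-adj : ∀ u v → adj H (embed u) (embed v) ≡ adj G u v
  embed-adj u v = cong₂ adjᶜ (splitAt-vertex (old u)) (splitAt-vertex (old v))

  embed-⊆ : ∀ {u v} → u ⊆ v → NbhdSub H (embed u) (embed v)
  embed-⊆ {u} {v} u⊆v =
    ≼⇒nbhdSub (subst₂ _≼_ (sym (splitAt-vertex (old u))) (sym (splitAt-vertex (old v))) (≼-old u⊆v))

  embed-spanningPair : ∀ {u v} → SpanningPair G u v → SpanningPair H (embed u) (embed v)
  embed-spanningPair {u} {v} span = spanning⇒spanningPair
    (subst₂ Spanning (sym (splitAt-vertex (old u))) (sym (splitAt-vertex (old v))) (spanning-old span))

  extension : CircularExtension G H
  extension = circularlyPaired , embed , (embed-injective , embed-adj) ,
              AdjacencyPreserving.preservesEdgeTypes G H embed embed-adj embed-⊆ embed-spanningPair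

  module AnyExtension (H′ : Graph) (paired′ : CircularlyPaired H′) (f : V G → V H′)
                      (f-injective : ∀ u v → f u ≡ f v → u ≡ v)
                      (f-adj : ∀ u v → adj H′ (f u) (f v) ≡ adj G u v) where

    module H′ = Neighbourhoods H′
    open AdjacencyPreserving G H′ f f-adj

    partner : V G → V H′
    partner u = proj₁ (paired′ (f u))

    partner-spanning : ∀ u → SpanningPair H′ (f u) (partner u)
    partner-spanning u = proj₁ (proj₂ (paired′ (f u)))

    partner-nonadj : ∀ u → adj H′ (f u) (partner u) ≡ false
    partner-nonadj u = proj₂ (proj₂ (paired′ (f u)))

    partner≢embedded : ∀ {u v} → Unpaired G u → partner u ≢ f v
    partner≢embedded {u} {v} unpaired eq = unpaired
      (v , circularPair-reflect (subst (CircularPair H′ (f u)) eq (proj₂ (paired′ (f u)))))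

    same-partner⇒⊆ : ∀ {u z} → partner u ≡ partner z → z ⊆ u
    same-partner⇒⊆ {u} {z} eq = nbhdSub-reflect (proj₁ (partner-spanning u) (f z) (begin
      adj H′ (partner u) (f z)  ≡⟨ cong (λ p → adj H′ p (f z)) eq ⟩
      adj H′ (partner z) (f z)  ≡⟨ adj-sym H′ (partner z) (f z) ⟩
      adj H′ (f z) (partner z)  ≡⟨ partner-nonadj z ⟩
      false                     ∎))
      where open ≡-Reasoning

    g : W → V H′
    g (old v) = f v
    g (new i) = partner (anchor i)

    g-injective : ∀ a b → g a ≡ g b → a ≡ b
    g-injective (old u) (old v) eq = cong old (f-injective u v eq)
    g-injective (old v) (new i) eq = ⊥-elim (partner≢embedded (anchor-unpaired i) (sym eq))
    g-injective (new i) (old v) eq = ⊥-elim (partner≢embedded (anchor-unpaired i) eq)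
    g-injective (new i) (new j) eq = cong new (anchor-injective i j
      (⊆-antisym no-twins (same-partner⇒⊆ (sym eq)) (same-partner⇒⊆ eq)))

    h : V H → V H′
    h x = g (splitAt n x)

    h-injective : ∀ x y → h x ≡ h y → x ≡ y
    h-injective x y eq = begin
      x                       ≡⟨ sym (join-splitAt n k x) ⟩
      vertex (splitAt n x)    ≡⟨ cong vertex (g-injective (splitAt n x) (splitAt n y) eq) ⟩
      vertex (splitAt n y)    ≡⟨ join-splitAt n k y ⟩
      y                       ∎
      where open ≡-Reasoning

    size-≤ : size H ≤ size H′
    size-≤ = injective⇒≤ {f = h} (h-injective _ _)

    module EdgeTypesPreserved (preserves : PreservesEdgeTypes G H′ f) where

      inclusion-preserved : ∀ {u v} → v ⊆ u → Comparable H′ (f u) (f v)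
      inclusion-preserved {u} {v} v⊆u =
        proj₂ (Equivalence.to (proj₁ (preserves u v (⊆⇒adj v⊆u))) (⊆⇒adj v⊆u , inj₂ v⊆u))

      twoOverlap-preserved : ∀ {u v} → TwoOverlapEdge G u v → TwoOverlapEdge H′ (f u) (f v)
      twoOverlap-preserved {u} {v} two =
        Equivalence.to (proj₁ (proj₂ (preserves u v (proj₁ (proj₁ two))))) two

      partner~embedded : ∀ {u v} → ¬ v ⊆ u → adj H′ (partner u) (f v) ≡ true
      partner~embedded {u} {v} v⊈u = ≢false⇒≡true λ pu≁fv →
        v⊈u (nbhdSub-reflect (proj₁ (partner-spanning u) (f v) pu≁fv))

      partner≁embedded : ∀ {u v} → v ⊆ u → adj H′ (partner u) (f v) ≡ false
      partner≁embedded {u} {v} v⊆u with inclusion-preserved v⊆u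
      ... | inj₁ fu⊆fv = subst (λ w → adj H′ (partner u) (f w) ≡ false)
                           (⊆-antisym no-twins (nbhdSub-reflect fu⊆fv) v⊆u)
                           (trans (adj-sym H′ (partner u) (f u)) (partner-nonadj u))
      ... | inj₂ fv⊆fu = ≢true⇒≡false λ pu~fv → ≡false⇒≢true (partner-nonadj u)
                           (fv⊆fu (partner u) (trans (adj-sym H′ (f v) (partner u)) pu~fv))

      partners≁ : ∀ {u z} → TwoOverlapEdge G u z → adj H′ (partner u) (partner z) ≡ false
      partners≁ {u} {z} two = ≢true⇒≡false λ pu~pz → ≡false⇒≢true (partner-nonadj u)
        (pz⊆fu (partner u) (trans (adj-sym H′ (partner z) (partner u)) pu~pz))
        where
        pz⊆fu : NbhdSub H′ (partner z) (f u)
        pz⊆fu = proj₁ (H′.twoOverlap⇒spanningPair (twoOverlap-preserved two)) (partner z)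
                  (partner-nonadj z)

      partners≁⇒twoOverlap : ∀ {u z} → Unpaired G u →
                             adj H′ (partner u) (partner z) ≡ false → TwoOverlapEdge G u z
      partners≁⇒twoOverlap {u} {z} unpaired pu≁pz =
        unpaired-spanningPair⇒twoOverlap unpaired span [ u⊈z , z⊈u ]
        where
        pz⊆fu : NbhdSub H′ (partner z) (f u)
        pz⊆fu = proj₁ (partner-spanning u) (partner z) pu≁pz

        pu⊆fz : NbhdSub H′ (partner u) (f z)
        pu⊆fz = proj₁ (partner-spanning z) (partner u)
                  (trans (adj-sym H′ (partner z) (partner u)) pu≁pz)

        span : SpanningPair G u z
        span = spanningPair-reflect
          (H′.spanningPair-mono (H′.spanningPair-sym (partner-spanning z)) pz⊆fu H′.⊆-refl)

        u⊈z : ¬ u ⊆ z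
        u⊈z u⊆z = ≡false⇒≢true (partner≁embedded u⊆z)
          (trans (adj-sym H′ (partner z) (f u)) (H′.⊆⇒adj pz⊆fu))

        z⊈u : ¬ z ⊆ u
        z⊈u z⊆u = ≡false⇒≢true (partner≁embedded z⊆u)
          (trans (adj-sym H′ (partner u) (f z)) (H′.⊆⇒adj pu⊆fz))

      partner-adj-embedded : ∀ u v → adj H′ (partner u) (f v) ≡ does (¬? (v ⊆? u))
      partner-adj-embedded u v = decide (v ⊆? u)
        where
        decide : (v⊆?u : Dec (v ⊆ u)) → adj H′ (partner u) (f v) ≡ does (¬? v⊆?u)
        decide (yes v⊆u) = partner≁embedded v⊆u
        decide (no v⊈u)  = partner~embedded v⊈u

      partners-adj : ∀ i j → adj H′ (partner (anchor i)) (partner (anchor j))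
                             ≡ does ((i ≟ᶠ j) ⊎-dec ¬? (twoOverlap? (anchor i) (anchor j)))
      partners-adj i j = decide (i ≟ᶠ j) (twoOverlap? (anchor i) (anchor j))
        where
        decide : (i≟j : Dec (i ≡ j)) (two? : Dec (TwoOverlapEdge G (anchor i) (anchor j))) →
                 adj H′ (partner (anchor i)) (partner (anchor j)) ≡ does (i≟j ⊎-dec ¬? two?)
        decide (yes refl) _          = adj-refl H′ (partner (anchor i))
        decide (no _)     (yes two)  = partners≁ two
        decide (no _)     (no ¬two)  = ≢false⇒≡true λ pu≁pz →
                                         ¬two (partners≁⇒twoOverlap (anchor-unpaired i) pu≁pz)

      g-adj : ∀ a b → adj H′ (g a) (g b) ≡ adjᶜ a b
      g-adj (old u) (old v) = f-adj u v
      g-adj (new i) (old v) = partner-adj-embedded (anchor i) v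
      g-adj (old v) (new i) = trans (adj-sym H′ (f v) (partner (anchor i)))
                                    (partner-adj-embedded (anchor i) v)
      g-adj (new i) (new j) = partners-adj i j

      iso : size H′ ≤ size H → Iso H H′
      iso size≤ = record
        { to       = h
        ; from     = λ y → proj₁ (onto y)
        ; from∘to  = λ x → h-injective _ _ (proj₂ (onto (h x)))
        ; to∘from  = λ y → proj₂ (onto y)
        ; adj-pres = λ x y → g-adj (splitAt n x) (splitAt n y)
        }
        where
        onto = injective⇒surjective h h-injective size≤

lemma15 : (G : Graph) → NoUniversal G → NoTrueTwins G →
    Σ Graph λ H → CircularCompletion G H ×
      (∀ H' → CircularCompletion G H' → Iso H H')
lemma15 G no-universal no-twins = H , (extension , minimal) , unique
  where
  open Completion G no-universal no-twins

  minimal : ∀ H′ → CircularExtension G H′ → size H ≤ size H′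
  minimal H′ (paired′ , f , (f-injective , f-adj) , _) =
    AnyExtension.size-≤ H′ paired′ f f-injective f-adj

  unique : ∀ H′ → CircularCompletion G H′ → Iso H H′
  unique H′ ((paired′ , f , (f-injective , f-adj) , preserves) , minimal′) =
    AnyExtension.EdgeTypesPreserved.iso H′ paired′ f f-injective f-adj preserves (minimal′ H extension)
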